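{- A tree $T$ is $T^*$-free if and only if $T$ contains a path $P$ such that every vertex of $T$ is at distance at most $2$ from $P$.
   Context: $T^*$ is the tree consisting of three paths of length $3$ sharing one common endpoint (a central vertex $x$ with three pendant paths $x,w_j,v_j,u_j$, $j=1,2,3$; ten vertices in total). A tree is $T^*$-free if it does not contain a subgraph isomorphic to $T^*$. The distance of a vertex from a path $P$ is the minimum graph distance from that vertex to a vertex of $P$. -}

module Defs where

open import Data.Nat using (ℕ; zero; suc; _≤_)
open import Data.Fin using (Fin; #_)
open import Data.List using (List; []; _∷_; _++_; [_]; length)
open import Data.List.Relation.Unary.Linked using (Linked)
open import Data.List.Relation.Unary.All using (All)
open import Data.List.Relation.Unary.Any using (Any)
open import Data.List.Relation.Unary.Unique.Propositional using (Unique)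
open import Data.List.Membership.Propositional using (_∈_)
open import Data.Product using (Σ; ∃; _×_; _,_)
open import Relation.Nullary using (¬_)
open import Data.Empty using (⊥)
open import Relation.Binary.PropositionalEquality using (_≡_)
open import Function.Definitions using (Injective)

record Graph (n : ℕ) : Set₁ where
  field
    Adj    : Fin n → Fin n → Set
    sym    : ∀ {u v} → Adj u v → Adj v u
    irrefl : ∀ {u} → ¬ Adj u u

module _ {n : ℕ} (G : Graph n) where
  open Graph G

  data Walk : Fin n → Fin n → ℕ → Set where
    []   : ∀ {u} → Walk u u 0
    step : ∀ {u w v k} → Adj u w → Walk w v k → Walk u v (suc k)

  Connected : Set
  Connected = ∀ u v → ∃ λ k → Walk u v k

  -- A cycle: distinct vertices x, x₁, …, x_m (m ≥ 2, so at least 3 vertices),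
  -- consecutive ones adjacent and the last adjacent to x.
  IsCycle : List (Fin n) → Set
  IsCycle [] = ⊥
  IsCycle (x ∷ xs) = 2 ≤ length xs × Unique (x ∷ xs) × Linked Adj (x ∷ xs ++ [ x ])

  Acyclic : Set
  Acyclic = ∀ c → ¬ IsCycle c

  IsTree : Set
  IsTree = 1 ≤ n × Connected × Acyclic

  IsPath : List (Fin n) → Set
  IsPath P = 1 ≤ length P × Unique P × Linked Adj P

  DistToPathLe : Fin n → List (Fin n) → ℕ → Set
  DistToPathLe v P d = ∃ λ p → p ∈ P × ∃ λ k → k ≤ d × Walk v p k

-- The tree T*: vertex 0 = x, 1..3 = w_j, 4..6 = v_j, 7..9 = u_j.
tstarEdges : List (Fin 10 × Fin 10)
tstarEdges =
  (# 0 , # 1) ∷ (# 1 , # 4) ∷ (# 4 , # 7) ∷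
  (# 0 , # 2) ∷ (# 2 , # 5) ∷ (# 5 , # 8) ∷
  (# 0 , # 3) ∷ (# 3 , # 6) ∷ (# 6 , # 9) ∷ []

ContainsTStar : ∀ {n} → Graph n → Set
ContainsTStar {n} G =
  Σ (Fin 10 → Fin n) λ f →
    Injective _≡_ _≡_ f × All (λ e → Graph.Adj G (f (Data.Product.proj₁ e)) (f (Data.Product.proj₂ e))) tstarEdges

TStarFree : ∀ {n} → Graph n → Set
TStarFree G = ¬ ContainsTStar G

module Submission where

-- Both directions rest on one fact about acyclic graphs: a walk without
-- immediate backtracking visits every vertex at most once.  Hence every walk
-- shortens to a path on a subset of its vertices, adjacency is decidable in a
-- tree, and two distinct neighbours of a vertex x cannot be joined by a walk
-- avoiding x ("separation").
--
-- (⇐) Let T* sit in T with centre x.  Each of its three legs x-w-v-u ends at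
-- u within distance 2 of P, which yields a walk from w to P avoiding x.  The
-- path P minus x has at most two x-free segments, so two legs reach the same
-- segment and, joined along it, contradict separation.
--
-- (⇒) Grow a path P.  If some vertex is farther than 2 from P, the last
-- departure from P of a path towards it is an arm root-c₁-c₂-c₃ off P.  If P
-- has at most two vertices on one side of the root, P is extended by the arm;
-- otherwise the arm and the three vertices on either side of the root form a
-- T*.  Paths have at most n vertices, so the growth terminates.

open import Defs
open import Data.Nat using (ℕ)
open import Data.Fin using (Fin)
open import Data.List using (List)
open import Data.Product using (∃; _×_)
open import Function.Bundles using (_⇔_)

open import Data.Nat using (zero; suc; _≤_; _<_; z≤n; s≤s; _+_; _≤?_)
open import Data.Nat.Properties
  using (≤-trans; ≤-refl; ≤-reflexive; n≤1+n; <⇒≢; <⇒≱; ≰⇒>; <-≤-trans; n<1+n;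
         +-identityʳ; +-suc; +-monoˡ-≤; +-monoʳ-<)
open import Data.Fin using (zero; suc; #_; fromℕ<; toℕ) renaming (_≟_ to _≟ᶠ_)
open import Data.Fin.Properties using (pigeonhole; any?; all?; ¬∀⟶∃¬)
open import Data.List using ([]; _∷_; _++_; [_]; length; lookup)
open import Data.List.Properties using (length-++; ++-assoc)
open import Data.List.Relation.Unary.Linked as Linked using (Linked; []; [-]; _∷_)
open import Data.List.Relation.Unary.All as All using (All; []; _∷_)
open import Data.List.Relation.Unary.All.Properties using (++⁻ˡ; ++⁻ʳ; ¬Any⇒All¬; anti-mono)
open import Data.List.Relation.Unary.Any as Any using (here; there)
open import Data.List.Relation.Unary.AllPairs using ([]; _∷_)
open import Data.List.Relation.Unary.Unique.Propositional using (Unique)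
import Data.List.Relation.Unary.Unique.Propositional.Properties as Unique
open import Data.List.Membership.Propositional using (_∈_; _∉_; find; lose)
open import Data.List.Membership.Propositional.Properties using (∈-lookup; ∈-∃++; ∈-++⁺ˡ; ∈-++⁺ʳ; ∈-++⁻)
open import Data.List.Relation.Binary.Subset.Propositional using (_⊆_)
open import Data.Product using (Σ; _,_; proj₁; proj₂)
open import Data.Sum using (_⊎_; inj₁; inj₂)
open import Data.Empty using (⊥; ⊥-elim)
open import Data.Unit using (⊤; tt)
open import Relation.Nullary using (¬_; Dec; yes; no)
open import Relation.Nullary.Decidable using (_×-dec_; False; toWitness; toWitnessFalse)
open import Relation.Binary.PropositionalEquality using (_≡_; _≢_; refl; sym; trans; cong; subst; subst₂)
open import Function.Bundles using (mk⇔)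
open import Function using (_∘_)

module _ {a} {A : Set a} where

  unique-++ˡ : (xs : List A) {ys : List A} → Unique (xs ++ ys) → Unique xs
  unique-++ˡ [] _ = []
  unique-++ˡ (x ∷ xs) (x∉ ∷ u) = ++⁻ˡ xs x∉ ∷ unique-++ˡ xs u

  unique-++ʳ : (xs : List A) {ys : List A} → Unique (xs ++ ys) → Unique ys
  unique-++ʳ [] u = u
  unique-++ʳ (x ∷ xs) (_ ∷ u) = unique-++ʳ xs u

  unique-++-disjoint : (xs : List A) {ys : List A} → Unique (xs ++ ys) →
                       ∀ {x y} → x ∈ xs → y ∈ ys → x ≢ y
  unique-++-disjoint (_ ∷ xs) (x∉ ∷ _) (here refl) y∈ = All.lookup (++⁻ʳ xs x∉) y∈
  unique-++-disjoint (_ ∷ xs) (_ ∷ u) (there x∈) y∈ = unique-++-disjoint xs u x∈ y∈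

  unique-pivot : (xs : List A) {x : A} {ys : List A} → Unique (xs ++ x ∷ ys) →
                 All (x ≢_) xs × All (x ≢_) ys
  unique-pivot xs u with unique-++ʳ xs u
  ... | x∉ys ∷ _ = ¬Any⇒All¬ xs (λ x∈ → unique-++-disjoint xs u x∈ (here refl) refl) , x∉ys

  lookup-injective : (xs : List A) → Unique xs → ∀ i j → lookup xs i ≡ lookup xs j → i ≡ j
  lookup-injective (x ∷ xs) (x∉ ∷ u) zero zero _ = refl
  lookup-injective (x ∷ xs) (x∉ ∷ u) zero (suc j) eq = ⊥-elim (All.lookup x∉ (∈-lookup j) eq)
  lookup-injective (x ∷ xs) (x∉ ∷ u) (suc i) zero eq = ⊥-elim (All.lookup x∉ (∈-lookup i) (sym eq))
  lookup-injective (x ∷ xs) (x∉ ∷ u) (suc i) (suc j) eq = cong suc (lookup-injective xs u i j eq)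

  short-or-ends3 : (xs : List A) →
    length xs ≤ 2 ⊎
    ∃ λ xs' → ∃ λ a₃ → ∃ λ a₂ → ∃ λ a₁ → ∀ ys → xs ++ ys ≡ xs' ++ a₃ ∷ a₂ ∷ a₁ ∷ ys
  short-or-ends3 [] = inj₁ z≤n
  short-or-ends3 (x ∷ []) = inj₁ (s≤s z≤n)
  short-or-ends3 (x ∷ y ∷ []) = inj₁ (s≤s (s≤s z≤n))
  short-or-ends3 (x ∷ y ∷ z ∷ []) = inj₂ ([] , x , y , z , λ _ → refl)
  short-or-ends3 (x ∷ xs@(_ ∷ _ ∷ _ ∷ _)) with short-or-ends3 xs
  ... | inj₁ (s≤s (s≤s ()))
  ... | inj₂ (xs' , a₃ , a₂ , a₁ , eq) = inj₂ (x ∷ xs' , a₃ , a₂ , a₁ , cong (x ∷_) ∘ eq)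

  short-or-starts3 : (xs : List A) →
    length xs ≤ 2 ⊎ ∃ λ b₁ → ∃ λ b₂ → ∃ λ b₃ → ∃ λ xs' → xs ≡ b₁ ∷ b₂ ∷ b₃ ∷ xs'
  short-or-starts3 [] = inj₁ z≤n
  short-or-starts3 (x ∷ []) = inj₁ (s≤s z≤n)
  short-or-starts3 (x ∷ y ∷ []) = inj₁ (s≤s (s≤s z≤n))
  short-or-starts3 (x ∷ y ∷ z ∷ xs') = inj₂ (x , y , z , xs' , refl)

  module _ {ℓ} {R : A → A → Set ℓ} where

    linked-++ˡ : (xs : List A) {ys : List A} → Linked R (xs ++ ys) → Linked R xs
    linked-++ˡ [] _ = []
    linked-++ˡ (x ∷ []) _ = [-]
    linked-++ˡ (x ∷ x' ∷ xs) (r ∷ l) = r ∷ linked-++ˡ (x' ∷ xs) l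

    linked-++ʳ : (xs : List A) {ys : List A} → Linked R (xs ++ ys) → Linked R ys
    linked-++ʳ [] l = l
    linked-++ʳ (x ∷ xs) l = linked-++ʳ xs (Linked.tail l)

    linked-glue : (xs : List A) {y : A} {ys : List A} →
                  Linked R (xs ++ [ y ]) → Linked R (y ∷ ys) → Linked R (xs ++ y ∷ ys)
    linked-glue [] _ l = l
    linked-glue (x ∷ []) (r ∷ _) l = r ∷ l
    linked-glue (x ∷ x' ∷ xs) (r ∷ l₁) l = r ∷ linked-glue (x' ∷ xs) l₁ l

    linked-upTo : (xs : List A) {y : A} {ys : List A} → Linked R (xs ++ y ∷ ys) → Linked R (xs ++ [ y ])
    linked-upTo xs {y} {ys} l = linked-++ˡ (xs ++ [ y ]) (subst (Linked R) (sym (++-assoc xs [ y ] ys)) l)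

unique-length : ∀ {n} (xs : List (Fin n)) → Unique xs → length xs ≤ n
unique-length {n} xs u with length xs ≤? n
... | yes ≤n = ≤n
... | no ≰n with pigeonhole (≰⇒> ≰n) (lookup xs)
... | i , j , i<j , eq = ⊥-elim (<⇒≢ i<j (cong toℕ (lookup-injective xs u i j eq)))

two-on-one-side : ∀ {A₁ B₁ A₂ B₂ A₃ B₃ : Set} → A₁ ⊎ B₁ → A₂ ⊎ B₂ → A₃ ⊎ B₃ →
  ((A₁ × A₂) ⊎ (B₁ × B₂)) ⊎ ((A₁ × A₃) ⊎ (B₁ × B₃)) ⊎ ((A₂ × A₃) ⊎ (B₂ × B₃))
two-on-one-side (inj₁ a₁) (inj₁ a₂) _ = inj₁ (inj₁ (a₁ , a₂))
two-on-one-side (inj₂ b₁) (inj₂ b₂) _ = inj₁ (inj₂ (b₁ , b₂))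
two-on-one-side (inj₁ a₁) (inj₂ _) (inj₁ a₃) = inj₂ (inj₁ (inj₁ (a₁ , a₃)))
two-on-one-side (inj₁ _) (inj₂ b₂) (inj₂ b₃) = inj₂ (inj₂ (inj₂ (b₂ , b₃)))
two-on-one-side (inj₂ _) (inj₁ a₂) (inj₁ a₃) = inj₂ (inj₂ (inj₁ (a₂ , a₃)))
two-on-one-side (inj₂ b₁) (inj₁ _) (inj₂ b₃) = inj₂ (inj₁ (inj₂ (b₁ , b₃)))

module Walks {n : ℕ} (G : Graph n) where
  open Graph G renaming (sym to adj-sym)

  later : ∀ {u v k} → Walk G u v k → List (Fin n)
  later [] = []
  later (step {w = w} _ W) = w ∷ later W

  verts : ∀ {u v k} → Walk G u v k → List (Fin n)
  verts {u} W = u ∷ later W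

  verts-linked : ∀ {u v k} (W : Walk G u v k) → Linked Adj (verts W)
  verts-linked [] = [-]
  verts-linked (step e W) = e ∷ verts-linked W

  end∈verts : ∀ {u v k} (W : Walk G u v k) → v ∈ verts W
  end∈verts [] = here refl
  end∈verts (step _ W) = there (end∈verts W)

  _++ʷ_ : ∀ {u v w k m} → Walk G u v k → Walk G v w m → Walk G u w (k + m)
  [] ++ʷ W₂ = W₂
  step e W₁ ++ʷ W₂ = step e (W₁ ++ʷ W₂)

  All-++ʷ : ∀ {p} {Q : Fin n → Set p} {u v w k m} (W₁ : Walk G u v k) (W₂ : Walk G v w m) →
            All Q (verts W₁) → All Q (verts W₂) → All Q (verts (W₁ ++ʷ W₂))
  All-++ʷ [] W₂ _ q₂ = q₂
  All-++ʷ (step e W₁) W₂ (q ∷ q₁) q₂ = q ∷ All-++ʷ W₁ W₂ q₁ q₂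

  snoc : ∀ {u v w k} → Walk G u v k → Adj v w → Walk G u w (suc k)
  snoc [] e = step e []
  snoc (step e' W) e = step e' (snoc W e)

  All-snoc : ∀ {p} {Q : Fin n → Set p} {u v w k} (W : Walk G u v k) (e : Adj v w) →
             All Q (verts W) → Q w → All Q (verts (snoc W e))
  All-snoc [] e (q ∷ []) q' = q ∷ q' ∷ []
  All-snoc (step e' W) e (q ∷ qs) q' = q ∷ All-snoc W e qs q'

  reverse : ∀ {u v k} → Walk G u v k → Walk G v u k
  reverse [] = []
  reverse (step e W) = snoc (reverse W) (adj-sym e)

  All-reverse : ∀ {p} {Q : Fin n → Set p} {u v k} (W : Walk G u v k) →
                All Q (verts W) → All Q (verts (reverse W))
  All-reverse [] qs = qs
  All-reverse (step e W) (q ∷ qs) = All-snoc (reverse W) (adj-sym e) (All-reverse W qs) q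

  walk-from-head : ∀ {p} {Q : Fin n → Set p} y ys → Linked Adj (y ∷ ys) → All Q (y ∷ ys) →
                   ∀ {b} → b ∈ y ∷ ys → ∃ λ k → Σ (Walk G y b k) λ W → All Q (verts W)
  walk-from-head y ys _ (q ∷ _) (here refl) = 0 , [] , q ∷ []
  walk-from-head y (y' ∷ ys) (r ∷ l) (q ∷ qs) (there b∈) with walk-from-head y' ys l qs b∈
  ... | k , W , qW = suc k , step r W , q ∷ qW

  walk-within : ∀ {p} {Q : Fin n → Set p} (xs : List (Fin n)) → Linked Adj xs → All Q xs →
                ∀ {a b} → a ∈ xs → b ∈ xs → ∃ λ k → Σ (Walk G a b k) λ W → All Q (verts W)
  walk-within (y ∷ ys) l qs (here refl) b∈ = walk-from-head y ys l qs b∈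
  walk-within (y ∷ ys) l qs (there a∈) (here refl) with walk-from-head y ys l qs (there a∈)
  ... | k , W , qW = k , reverse W , All-reverse W qW
  walk-within (y ∷ ys) l (_ ∷ qs) (there a∈) (there b∈) = walk-within ys (Linked.tail l) qs a∈ b∈

  NonBacktracking : List (Fin n) → Set
  NonBacktracking (x ∷ y ∷ z ∷ xs) = x ≢ z × NonBacktracking (y ∷ z ∷ xs)
  NonBacktracking _ = ⊤

  nonBacktracking-tail : ∀ {x} xs → NonBacktracking (x ∷ xs) → NonBacktracking xs
  nonBacktracking-tail [] _ = tt
  nonBacktracking-tail (_ ∷ []) _ = tt
  nonBacktracking-tail (_ ∷ _ ∷ _) (_ , nb) = nb

  record Reduction {u v k} (W : Walk G u v k) : Set where
    constructor reduction
    field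
      {length'} : ℕ
      walk      : Walk G u v length'
      nonBack   : NonBacktracking (verts walk)
      shorter   : length' ≤ k
      fewer     : verts walk ⊆ verts W

  -- Prepending an edge to a reduced walk either cancels its first edge or keeps it.
  reduce-step : ∀ {u w v k} (e : Adj u w) (W : Walk G w v k) → Reduction W → Reduction (step e W)
  reduce-step {u} e W (reduction (step {w = y} e' W') nb le sub) with u ≟ᶠ y
  ... | yes refl = reduction W' (nonBacktracking-tail (verts W') nb)
                     (≤-trans (n≤1+n _) (≤-trans le (n≤1+n _))) (there ∘ sub ∘ there)
  ... | no u≢y = reduction (step e (step e' W')) (u≢y , nb) (s≤s le)
                   λ { (here eq) → here eq ; (there m) → there (sub m) }
  reduce-step e W (reduction [] nb le sub) =
    reduction (step e []) tt (s≤s z≤n) λ { (here eq) → here eq ; (there m) → there (sub m) }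

  reduce : ∀ {u v k} (W : Walk G u v k) → Reduction W
  reduce [] = reduction [] tt z≤n (λ m → m)
  reduce (step e W) = reduce-step e W (reduce W)

module Acyclic-Graph {n : ℕ} (G : Graph n) (acyclic : Acyclic G) where
  open Graph G renaming (sym to adj-sym)
  open Walks G

  no-return : ∀ x pre post → Unique (pre ++ x ∷ post) → Linked Adj (x ∷ pre ++ x ∷ post) →
              NonBacktracking (x ∷ pre ++ x ∷ post) → ⊥
  no-return x pre post u l nb =
    acyclic (x ∷ pre) (long-enough pre l nb , proj₁ (unique-pivot pre u) ∷ unique-++ˡ pre u , linked-upTo (x ∷ pre) l)
    where
    -- one edge would be a loop and two edges x y x would backtrack
    long-enough : ∀ pre → Linked Adj (x ∷ pre ++ x ∷ post) → NonBacktracking (x ∷ pre ++ x ∷ post) →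
                  2 ≤ length pre
    long-enough [] (loop ∷ _) _ = ⊥-elim (irrefl loop)
    long-enough (_ ∷ []) _ (x≢x , _) = ⊥-elim (x≢x refl)
    long-enough (_ ∷ _ ∷ _) _ _ = s≤s (s≤s z≤n)

  nonBacktracking⇒unique : (xs : List (Fin n)) → Linked Adj xs → NonBacktracking xs → Unique xs
  nonBacktracking⇒unique [] _ _ = []
  nonBacktracking⇒unique (x ∷ xs) l nb = ¬Any⇒All¬ xs x∉xs ∷ uniq
    where
    uniq : Unique xs
    uniq = nonBacktracking⇒unique xs (Linked.tail l) (nonBacktracking-tail xs nb)
    x∉xs : x ∉ xs
    x∉xs x∈xs with ∈-∃++ x∈xs
    ... | pre , post , refl = no-return x pre post uniq l nb

  no-closing-edge : ∀ {u a c v k} (e₁ : Adj u a) (e₂ : Adj a c) (R : Walk G c v k) →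
                    NonBacktracking (verts (step e₁ (step e₂ R))) → ¬ Adj v u
  no-closing-edge {a = a} {v = v} e₁ e₂ R nb e = All.lookup v∉W (end∈verts W) refl
    where
    W = step e₁ (step e₂ R)
    a≢v : a ≢ v
    a≢v with nonBacktracking⇒unique (verts W) (verts-linked W) nb
    ... | _ ∷ (a∉R ∷ _) = All.lookup a∉R (end∈verts R)
    v∉W : All (v ≢_) (verts W)
    v∉W with nonBacktracking⇒unique (verts (step e W)) (verts-linked (step e W)) (a≢v ∘ sym , nb)
    ... | v∉ ∷ _ = v∉

  separation : ∀ {x a b k} → Adj x a → Adj x b → a ≢ b → (W : Walk G a b k) → ¬ All (x ≢_) (verts W)
  separation ea eb a≢b W avoids with reduce W
  ... | reduction [] _ _ _ = a≢b refl
  ... | reduction (step e R) nb _ fewer with anti-mono fewer avoids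
  ...   | _ ∷ x≢c ∷ _ = no-closing-edge ea e R (x≢c , nb) (adj-sym eb)

  Route : Fin n → Fin n → Fin n → Set
  Route x w p = ∃ λ k → Σ (Walk G w p k) λ S → All (x ≢_) (verts S)

  route : ∀ {x w p k} → Adj x w → (S : Walk G w p k) → NonBacktracking (x ∷ verts S) → Route x w p
  route e S nb with nonBacktracking⇒unique (verts (step e S)) (verts-linked (step e S)) nb
  ... | x∉S ∷ _ = _ , S , x∉S

  leg-route : ∀ {x w v u p k} → Adj x w → Adj w v → Adj v u → x ≢ v → w ≢ u →
              (Q : Walk G u p k) → NonBacktracking (verts Q) → k ≤ 2 → Route x w p
  leg-route exw ewv evu x≢v w≢u [] _ _ = route exw (step ewv (step evu [])) (x≢v , w≢u , tt)
  leg-route {v = v} exw ewv evu x≢v w≢u (step {w = a} e []) _ _ with a ≟ᶠ v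
  ... | yes refl = route exw (step ewv []) (x≢v , tt)
  ... | no a≢v = route exw (step ewv (step evu (step e []))) (x≢v , w≢u , a≢v ∘ sym , tt)
  leg-route {w = w} {v = v} exw ewv evu x≢v w≢u (step {w = a} e (step {w = b} e' [])) (u≢b , _) _
    with a ≟ᶠ v
  ... | no a≢v = route exw (step ewv (step evu (step e (step e' [])))) (x≢v , w≢u , a≢v ∘ sym , u≢b , tt)
  ... | yes refl with b ≟ᶠ w
  ...   | yes refl = route exw [] tt
  ...   | no b≢w = route exw (step ewv (step e' [])) (x≢v , b≢w ∘ sym , tt)
  leg-route _ _ _ _ _ (step _ (step _ (step _ _))) _ (s≤s (s≤s ()))

  Reaches : List (Fin n) → Fin n → Fin n → Set
  Reaches P x w = ∃ λ p → p ∈ P × Route x w p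

  leg-reaches : ∀ {x w v u} → Adj x w → Adj w v → Adj v u → x ≢ v → w ≢ u →
                ∀ P → DistToPathLe G u P 2 → Reaches P x w
  leg-reaches exw ewv evu x≢v w≢u P (p , p∈P , k , k≤2 , Q) with reduce Q
  ... | reduction Q' nb shorter _ = p , p∈P , leg-route exw ewv evu x≢v w≢u Q' nb (≤-trans shorter k≤2)

  -- Routes from distinct neighbours of x into one x-free linked list would contradict separation.
  routes-apart : ∀ {x w₁ w₂ p₁ p₂} → Adj x w₁ → Adj x w₂ → w₁ ≢ w₂ → Route x w₁ p₁ → Route x w₂ p₂ →
                 ∀ L → Linked Adj L → All (x ≢_) L → p₁ ∈ L → p₂ ∈ L → ⊥
  routes-apart e₁ e₂ w₁≢w₂ (_ , S₁ , a₁) (_ , S₂ , a₂) L l aL p₁∈L p₂∈L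
    with walk-within L l aL p₁∈L p₂∈L
  ... | _ , M , aM = separation e₁ e₂ w₁≢w₂ (S₁ ++ʷ (M ++ʷ reverse S₂))
                       (All-++ʷ S₁ _ a₁ (All-++ʷ M (reverse S₂) aM (All-reverse S₂ a₂)))

  record Split (x : Fin n) (P : List (Fin n)) : Set where
    field
      left right    : List (Fin n)
      left-linked   : Linked Adj left
      left-avoids   : All (x ≢_) left
      right-linked  : Linked Adj right
      right-avoids  : All (x ≢_) right
      covers        : ∀ {p} → p ∈ P → p ≢ x → p ∈ left ⊎ p ∈ right

  split-path : ∀ x P → Unique P → Linked Adj P → Split x P
  split-path x P uP lP with Any.any? (x ≟ᶠ_) P
  ... | no x∉P = record { left = P ; right = [] ; left-linked = lP ; left-avoids = ¬Any⇒All¬ P x∉P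
                        ; right-linked = [] ; right-avoids = [] ; covers = λ p∈P _ → inj₁ p∈P }
  ... | yes x∈P with ∈-∃++ x∈P
  ... | A , B , refl = record { left = A ; right = B ; left-linked = linked-++ˡ A lP
                              ; left-avoids = proj₁ (unique-pivot A uP)
                              ; right-linked = Linked.tail (linked-++ʳ A lP)
                              ; right-avoids = proj₂ (unique-pivot A uP) ; covers = side }
    where
    side : ∀ {p} → p ∈ A ++ x ∷ B → p ≢ x → p ∈ A ⊎ p ∈ B
    side p∈P p≢x with ∈-++⁻ A p∈P
    ... | inj₁ p∈A = inj₁ p∈A
    ... | inj₂ (here refl) = ⊥-elim (p≢x refl)
    ... | inj₂ (there p∈B) = inj₂ p∈B

  dominatingPath⇒TStarFree : ∀ P → IsPath G P → (∀ v → DistToPathLe G v P 2) → TStarFree G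
  dominatingPath⇒TStarFree P (_ , uP , lP) dom
    (f , inj , ex₁ ∷ e₁₄ ∷ e₄₇ ∷ ex₂ ∷ e₂₅ ∷ e₅₈ ∷ ex₃ ∷ e₃₆ ∷ e₆₉ ∷ []) =
    clash (two-on-one-side (lands r₁) (lands r₂) (lands r₃))
    where
    x = f (# 0)
    open Split (split-path x P uP lP)

    f≢ : ∀ i j {i≢j : False (i ≟ᶠ j)} → f i ≢ f j
    f≢ i j {i≢j} = toWitnessFalse i≢j ∘ inj

    r₁ : Reaches P x (f (# 1))
    r₁ = leg-reaches ex₁ e₁₄ e₄₇ (f≢ (# 0) (# 4)) (f≢ (# 1) (# 7)) P (dom _)
    r₂ : Reaches P x (f (# 2))
    r₂ = leg-reaches ex₂ e₂₅ e₅₈ (f≢ (# 0) (# 5)) (f≢ (# 2) (# 8)) P (dom _)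
    r₃ : Reaches P x (f (# 3))
    r₃ = leg-reaches ex₃ e₃₆ e₆₉ (f≢ (# 0) (# 6)) (f≢ (# 3) (# 9)) P (dom _)

    lands : ∀ {w} (r : Reaches P x w) → proj₁ r ∈ left ⊎ proj₁ r ∈ right
    lands (_ , p∈P , _ , S , avoids) = covers p∈P (λ p≡x → All.lookup avoids (end∈verts S) (sym p≡x))

    SameSide : ∀ {w w'} → Reaches P x w → Reaches P x w' → Set
    SameSide r r' = (proj₁ r ∈ left × proj₁ r' ∈ left) ⊎ (proj₁ r ∈ right × proj₁ r' ∈ right)

    meet : ∀ {w w'} (r : Reaches P x w) (r' : Reaches P x w') → Adj x w → Adj x w' → w ≢ w' →
           SameSide r r' → ⊥
    meet (_ , _ , ρ) (_ , _ , ρ') e e' w≢w' (inj₁ (p∈ , p'∈)) =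
      routes-apart e e' w≢w' ρ ρ' left left-linked left-avoids p∈ p'∈
    meet (_ , _ , ρ) (_ , _ , ρ') e e' w≢w' (inj₂ (p∈ , p'∈)) =
      routes-apart e e' w≢w' ρ ρ' right right-linked right-avoids p∈ p'∈

    clash : SameSide r₁ r₂ ⊎ SameSide r₁ r₃ ⊎ SameSide r₂ r₃ → ⊥
    clash (inj₁ s) = meet r₁ r₂ ex₁ ex₂ (f≢ (# 1) (# 2)) s
    clash (inj₂ (inj₁ s)) = meet r₁ r₃ ex₁ ex₃ (f≢ (# 1) (# 3)) s
    clash (inj₂ (inj₂ s)) = meet r₂ r₃ ex₂ ex₃ (f≢ (# 2) (# 3)) s

-- T*-vertex i (numbered as in tstarEdges) sits at position (position i) of the
-- list a₃ a₂ a₁ x b₁ b₂ b₃ c₁ c₂ c₃ formed by a spine centred at x and an arm x c₁ c₂ c₃.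
position : Fin 10 → Fin 10
position = lookup (# 3 ∷ # 2 ∷ # 4 ∷ # 7 ∷ # 1 ∷ # 5 ∷ # 8 ∷ # 0 ∷ # 6 ∷ # 9 ∷ [])

position-injective : ∀ {i j} → position i ≡ position j → i ≡ j
position-injective {i} {j} eq = trans (sym (inverse i)) (trans (cong position⁻¹ eq) (inverse j))
  where
  position⁻¹ : Fin 10 → Fin 10
  position⁻¹ = lookup (# 7 ∷ # 4 ∷ # 1 ∷ # 0 ∷ # 2 ∷ # 5 ∷ # 8 ∷ # 3 ∷ # 6 ∷ # 9 ∷ [])
  inverse : ∀ i → position⁻¹ (position i) ≡ i
  inverse = toWitness {a? = all? λ i → position⁻¹ (position i) ≟ᶠ i} tt

module Arms {n : ℕ} (G : Graph n) where
  open Graph G renaming (sym to adj-sym)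

  spine-arm⇒TStar : ∀ {a₃ a₂ a₁ x b₁ b₂ b₃ c₁ c₂ c₃} →
    Unique (a₃ ∷ a₂ ∷ a₁ ∷ x ∷ b₁ ∷ b₂ ∷ b₃ ∷ c₁ ∷ c₂ ∷ c₃ ∷ []) →
    Linked Adj (a₃ ∷ a₂ ∷ a₁ ∷ x ∷ b₁ ∷ b₂ ∷ b₃ ∷ []) →
    Linked Adj (x ∷ c₁ ∷ c₂ ∷ c₃ ∷ []) → ContainsTStar G
  spine-arm⇒TStar {a₃} {a₂} {a₁} {x} {b₁} {b₂} {b₃} {c₁} {c₂} {c₃} u
                  (k₁ ∷ k₂ ∷ k₃ ∷ k₄ ∷ k₅ ∷ k₆ ∷ [-]) (e₁ ∷ e₂ ∷ e₃ ∷ [-]) =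
    f , (λ eq → position-injective (lookup-injective L u _ _ eq)) , edges
    where
    L = a₃ ∷ a₂ ∷ a₁ ∷ x ∷ b₁ ∷ b₂ ∷ b₃ ∷ c₁ ∷ c₂ ∷ c₃ ∷ []
    f : Fin 10 → Fin n
    f = lookup L ∘ position
    edges = adj-sym k₃ ∷ adj-sym k₂ ∷ adj-sym k₁ ∷ k₄ ∷ k₅ ∷ k₆ ∷ e₁ ∷ e₂ ∷ e₃ ∷ []

  record Arm (P : List (Fin n)) (root : Fin n) : Set where
    constructor arm
    field
      {c₁ c₂ c₃} : Fin n
      linked     : Linked Adj (root ∷ c₁ ∷ c₂ ∷ c₃ ∷ [])
      unique     : Unique (root ∷ c₁ ∷ c₂ ∷ c₃ ∷ [])
      outside    : All (_∉ P) (c₁ ∷ c₂ ∷ c₃ ∷ [])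

  Longer : List (Fin n) → Set
  Longer P = ∃ λ P' → IsPath G P' × length P < length P'

  longer-path : ∀ {P} P' → Unique P' → Linked Adj P' → length P < length P' → Longer P
  longer-path P' u l longer = P' , (≤-trans (s≤s z≤n) longer , u , l) , longer

  -- Few vertices before the root: put the reversed arm in front of the root.
  prepend-arm : ∀ A {root} B → length A ≤ 2 → Unique (A ++ root ∷ B) → Linked Adj (A ++ root ∷ B) →
                Arm (A ++ root ∷ B) root → Longer (A ++ root ∷ B)
  prepend-arm A {root} B short uP lP
              (arm {c₁} {c₂} {c₃} (e₁ ∷ e₂ ∷ e₃ ∷ [-]) (_ ∷ (c₁≢c₂ ∷ c₁≢c₃ ∷ []) ∷ (c₂≢c₃ ∷ []) ∷ _)
                   (o₁ ∷ o₂ ∷ o₃ ∷ [])) =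
    longer-path {A ++ root ∷ B} (c₃ ∷ c₂ ∷ c₁ ∷ root ∷ B)
      ((c₂≢c₃ ∘ sym ∷ c₁≢c₃ ∘ sym ∷ off o₃) ∷ (c₁≢c₂ ∘ sym ∷ off o₂) ∷ off o₁ ∷ unique-++ʳ A uP)
      (adj-sym e₃ ∷ adj-sym e₂ ∷ adj-sym e₁ ∷ linked-++ʳ A lP)
      (subst (_< _) (sym (length-++ A)) (s≤s (+-monoˡ-≤ (suc (length B)) short)))
    where
    off : ∀ {c} → c ∉ A ++ root ∷ B → All (c ≢_) (root ∷ B)
    off c∉P = ¬Any⇒All¬ _ (c∉P ∘ ∈-++⁺ʳ A)

  -- Few vertices after the root: replace them by the arm.
  append-arm : ∀ A {root} B → length B ≤ 2 → Unique (A ++ root ∷ B) → Linked Adj (A ++ root ∷ B) →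
               Arm (A ++ root ∷ B) root → Longer (A ++ root ∷ B)
  append-arm A {root} B short uP lP (arm {c₁} {c₂} {c₃} l u outside) =
    longer-path {A ++ root ∷ B} (A ++ root ∷ c₁ ∷ c₂ ∷ c₃ ∷ [])
      (Unique.++⁺ (unique-++ˡ A uP) u disjoint)
      (linked-glue A (linked-upTo A lP) l)
      (subst₂ _<_ (sym (length-++ A)) (sym (length-++ A)) (+-monoʳ-< (length A) (s≤s (s≤s short))))
    where
    disjoint : ∀ {v} → ¬ (v ∈ A × v ∈ root ∷ c₁ ∷ c₂ ∷ c₃ ∷ [])
    disjoint (v∈A , here refl) = unique-++-disjoint A uP v∈A (here refl) refl
    disjoint (v∈A , there v∈C) = All.lookup outside v∈C (∈-++⁺ˡ v∈A)

  long-sides⇒TStar : ∀ A' {a₃ a₂ a₁ root b₁ b₂ b₃} B' →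
    let P = A' ++ a₃ ∷ a₂ ∷ a₁ ∷ root ∷ b₁ ∷ b₂ ∷ b₃ ∷ B' in
    Unique P → Linked Adj P → Arm P root → ContainsTStar G
  long-sides⇒TStar A' {a₃} {a₂} {a₁} {root} {b₁} {b₂} {b₃} B' uP lP (arm l (_ ∷ uC) outside) =
    spine-arm⇒TStar (Unique.++⁺ (unique-++ˡ spine (unique-++ʳ A' uP)) uC disjoint)
                    (linked-++ˡ spine (linked-++ʳ A' lP)) l
    where
    spine = a₃ ∷ a₂ ∷ a₁ ∷ root ∷ b₁ ∷ b₂ ∷ b₃ ∷ []
    disjoint : ∀ {v} → ¬ (v ∈ spine × v ∈ _)
    disjoint (v∈spine , v∈C) = All.lookup outside v∈C (∈-++⁺ʳ A' (∈-++⁺ˡ v∈spine))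

  extend-or-TStar : ∀ {P root} → Unique P → Linked Adj P → root ∈ P → Arm P root → Longer P ⊎ ContainsTStar G
  extend-or-TStar uP lP root∈P a with ∈-∃++ root∈P
  ... | A , B , refl with short-or-ends3 A | short-or-starts3 B
  ... | inj₁ short | _ = inj₁ (prepend-arm A B short uP lP a)
  ... | inj₂ _ | inj₁ short = inj₁ (append-arm A B short uP lP a)
  ... | inj₂ (A' , _ , _ , _ , eq) | inj₂ (_ , _ , _ , B' , refl) =
    inj₂ (long-sides⇒TStar A' B' (subst Unique (eq _) uP) (subst (Linked Adj) (eq _) lP)
                                  (subst (λ P → Arm P _) (eq _) a))

DominatingPath : ∀ {n} → Graph n → List (Fin n) → Set
DominatingPath {n} G P = IsPath G P × ((v : Fin n) → DistToPathLe G v P 2)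

module Growth {n : ℕ} (G : Graph n) (acyclic : Acyclic G) (connected : Connected G) where
  open Graph G renaming (sym to adj-sym)
  open Walks G
  open Acyclic-Graph G acyclic
  open Arms G

  -- Adjacency in a tree is decidable: reduce any walk between the two vertices.
  adjacent? : ∀ u v → Dec (Adj u v)
  adjacent? u v with reduce (proj₂ (connected u v))
  ... | reduction [] _ _ _ = no irrefl
  ... | reduction (step e []) _ _ _ = yes e
  ... | reduction (step e₁ (step e₂ R)) nb _ _ = no (no-closing-edge e₁ e₂ R nb ∘ adj-sym)

  within-2? : ∀ v p → Dec (∃ λ k → k ≤ 2 × Walk G v p k)
  within-2? v p with v ≟ᶠ p | adjacent? v p | any? (λ a → adjacent? v a ×-dec adjacent? a p)
  ... | yes refl | _ | _ = yes (0 , z≤n , [])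
  ... | no _ | yes e | _ = yes (1 , s≤s z≤n , step e [])
  ... | no _ | no _ | yes (_ , e₁ , e₂) = yes (2 , ≤-refl , step e₁ (step e₂ []))
  ... | no v≢p | no ¬e | no ¬a = no λ
    { (0 , _ , []) → v≢p refl
    ; (1 , _ , step e []) → ¬e e
    ; (2 , _ , step e₁ (step e₂ [])) → ¬a (_ , e₁ , e₂)
    ; (suc (suc (suc _)) , s≤s (s≤s ()) , _) }

  dominated? : ∀ v P → Dec (DistToPathLe G v P 2)
  dominated? v P with Any.any? (within-2? v) P
  ... | yes near with find near
  ...   | p , p∈P , d = yes (p , p∈P , d)
  dominated? v P | no ¬near = no λ (_ , p∈P , d) → ¬near (lose p∈P d)

  record Departure (P : List (Fin n)) (v : Fin n) : Set where
    constructor departure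
    field
      {root}  : Fin n
      root∈P  : root ∈ P
      {len}   : ℕ
      walk    : Walk G root v len
      unique  : Unique (verts walk)
      leaves  : All (_∉ P) (later walk)

  last-departure : ∀ P {u v k} (W : Walk G u v k) → Unique (verts W) → All (_∉ P) (verts W) ⊎ Departure P v
  last-departure P {u} [] uW with Any.any? (u ≟ᶠ_) P
  ... | yes u∈P = inj₂ (departure u∈P [] uW [])
  ... | no u∉P = inj₁ (u∉P ∷ [])
  last-departure P {u} (step e W) uW@(_ ∷ uW') with last-departure P W uW'
  ... | inj₂ d = inj₂ d
  ... | inj₁ off with Any.any? (u ≟ᶠ_) P
  ...   | yes u∈P = inj₂ (departure u∈P (step e W) uW off)
  ...   | no u∉P = inj₁ (u∉P ∷ off)

  departure-arm : ∀ {P v root k} → ¬ DistToPathLe G v P 2 → root ∈ P → (S : Walk G root v k) →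
                  Unique (verts S) → All (_∉ P) (later S) → Arm P root
  departure-arm far r∈P [] _ _ = ⊥-elim (far (_ , r∈P , _ , z≤n , []))
  departure-arm far r∈P S@(step _ []) _ _ = ⊥-elim (far (_ , r∈P , _ , s≤s z≤n , reverse S))
  departure-arm far r∈P S@(step _ (step _ [])) _ _ = ⊥-elim (far (_ , r∈P , _ , s≤s (s≤s z≤n) , reverse S))
  departure-arm _ _ (step e₁ (step e₂ (step e₃ _))) uS (o₁ ∷ o₂ ∷ o₃ ∷ _) =
    arm (e₁ ∷ e₂ ∷ e₃ ∷ [-]) (Unique.take⁺ 4 uS) (o₁ ∷ o₂ ∷ o₃ ∷ [])

  arm-towards : ∀ {P} → 1 ≤ length P → ∀ v → ¬ DistToPathLe G v P 2 → ∃ λ root → root ∈ P × Arm P root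
  arm-towards {p₀ ∷ P} _ v far with reduce (proj₂ (connected p₀ v))
  ... | reduction W nb _ _
    with last-departure (p₀ ∷ P) W (nonBacktracking⇒unique (verts W) (verts-linked W) nb)
  ... | inj₁ (p₀∉P ∷ _) = ⊥-elim (p₀∉P (here refl))
  ... | inj₂ (departure root∈P S uS out) = _ , root∈P , departure-arm far root∈P S uS out

  -- Each step lengthens P, and a path has at most n vertices: fuel bounds the steps left.
  grow : ∀ fuel P → IsPath G P → n < length P + fuel → (∃ λ P → DominatingPath G P) ⊎ ContainsTStar G
  grow zero P (_ , uP , _) bound = ⊥-elim (<⇒≱ bound (≤-trans (≤-reflexive (+-identityʳ _)) (unique-length P uP)))
  grow (suc fuel) P isP@(nonempty , uP , lP) bound with all? (λ v → dominated? v P)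
  ... | yes dom = inj₁ (P , isP , dom)
  ... | no ¬dom with ¬∀⟶∃¬ n _ (λ v → dominated? v P) ¬dom
  ... | v , far with arm-towards nonempty v far
  ... | root , root∈P , a with extend-or-TStar uP lP root∈P a
  ... | inj₂ tstar = inj₂ tstar
  ... | inj₁ (P' , isP' , longer) =
    grow fuel P' isP' (<-≤-trans bound (≤-trans (≤-reflexive (+-suc _ fuel)) (+-monoˡ-≤ fuel longer)))

  dominatingPath-or-TStar : 1 ≤ n → (∃ λ P → DominatingPath G P) ⊎ ContainsTStar G
  dominatingPath-or-TStar 1≤n = grow n [ fromℕ< 1≤n ] (s≤s z≤n , [] ∷ [] , [-]) (n<1+n n)

lemma4 : (n : ℕ) (T : Graph n) → IsTree T →
    (TStarFree T ⇔ (∃ λ (P : List (Fin n)) → IsPath T P × ((v : Fin n) → DistToPathLe T v P 2)))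
lemma4 n T (1≤n , connected , acyclic) = mk⇔ free⇒path path⇒free
  where
  free⇒path : TStarFree T → ∃ (DominatingPath T)
  free⇒path free with Growth.dominatingPath-or-TStar T acyclic connected 1≤n
  ... | inj₁ path = path
  ... | inj₂ tstar = ⊥-elim (free tstar)

  path⇒free : ∃ (DominatingPath T) → TStarFree T
  path⇒free (P , isP , dom) = Acyclic-Graph.dominatingPath⇒TStarFree T acyclic P isP dom
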